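{- Let $G$ be a finite simple undirected graph with property S. Then, in the game Graph Nimors, $G$ is a $\mathcal{P}$-position (the player who moved previously, i.e. the second player to move from $G$, has a winning strategy) if and only if $G$ has an even number of edges.
   Context: Graph Nimors is the impartial two-player game in which a position is a finite simple undirected graph and a move consists of either deleting one edge, or contracting one edge $uv$ (removing the adjacent vertices $u,v$ and inserting a new vertex $w$ adjacent to the union of the neighbourhoods of $u$ and $v$, excluding $u$ and $v$ themselves, so the result is again simple). Play continues until no edges remain; a player unable to move loses. A position is a $\mathcal{P}$-position if the previous player (the one not about to move) can force a win, and an $\mathcal{N}$-position if the next player to move can force a win; every position is exactly one of these. The blocks of a graph are its maximal biconnected subgraphs, where a single edge not contained in any cycle also counts as a block, so the edge set is partitioned into blocks. A graph $G$ has property S if it contains no edge both of whose endpoints have degree greater than two, and no block of $G$ is a triangle. -}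

module Defs where

open import Data.Nat using (ℕ; zero; suc; _+_; _*_; _<_; _≤?_; _≟_)
open import Data.Product using (Σ; ∃; ∃-syntax; _×_; _,_; proj₁; proj₂)
open import Data.Product.Properties using (≡-dec)
open import Data.Sum using (_⊎_)
open import Data.List using (List; []; _∷_; length; filter; map; deduplicate)
open import Data.List.Membership.Propositional using (_∈_)
open import Data.List.Relation.Unary.All using (All)
open import Data.List.Relation.Unary.Unique.Propositional using (Unique)
open import Relation.Nullary using (¬_; Dec; yes; no; ¬?)
open import Relation.Binary.PropositionalEquality using (_≡_; _≢_)

-- A finite simple undirected graph is represented by its edge
-- list: vertices are natural numbers, an edge {x,y} is stored as the
-- pair (x , y) with x < y, and no edge is listed twice.  Isolated
-- vertices are irrelevant to Graph Nimors and to property S, so they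
-- are not represented.

Edge : Set
Edge = ℕ × ℕ

Graph : Set
Graph = List Edge

IsSimpleGraph : Graph → Set
IsSimpleGraph G = All (λ e → proj₁ e < proj₂ e) G × Unique G

_≟ₑ_ : (e f : Edge) → Dec (e ≡ f)
_≟ₑ_ = ≡-dec _≟_ _≟_

Adj : Graph → ℕ → ℕ → Set
Adj G x y = (x , y) ∈ G ⊎ (y , x) ∈ G

IsVertex : Graph → ℕ → Set
IsVertex G x = ∃[ y ] Adj G x y

Incident : ℕ → Edge → Set
Incident x e = x ≡ proj₁ e ⊎ x ≡ proj₂ e

incident? : (x : ℕ) (e : Edge) → Dec (Incident x e)
incident? x (a , b) with x ≟ a | x ≟ b
... | yes p | _     = yes (_⊎_.inj₁ p)
... | no _  | yes q = yes (_⊎_.inj₂ q)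
... | no p  | no q  = no λ { (_⊎_.inj₁ r) → p r ; (_⊎_.inj₂ r) → q r }

degree : Graph → ℕ → ℕ
degree G x = length (filter (incident? x) G)

deleteEdge : Edge → Graph → Graph
deleteEdge e G = filter (λ f → ¬? (f ≟ₑ e)) G

-- contract the edge (u , v): the merged vertex is named u; every
-- occurrence of v is renamed to u, the resulting loop (u,u) is dropped,
-- pairs are re-normalised (smaller endpoint first) and duplicate
-- (parallel) edges are removed, so the result is again simple.
renameV : ℕ → ℕ → ℕ → ℕ
renameV u v z with z ≟ v
... | yes _ = u
... | no  _ = z

normalise : Edge → Edge
normalise (p , q) with p ≤? q
... | yes _ = (p , q)
... | no  _ = (q , p)

notLoop? : (e : Edge) → Dec (¬ (proj₁ e ≡ proj₂ e))
notLoop? (p , q) = ¬? (p ≟ q)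

contractEdge : Edge → Graph → Graph
contractEdge (u , v) G =
  deduplicate _≟ₑ_
    (filter notLoop? (map (λ e → normalise (renameV u v (proj₁ e) , renameV u v (proj₂ e))) G))

Move : Graph → Graph → Set
Move G H = Σ Edge λ e → e ∈ G × (H ≡ deleteEdge e G ⊎ H ≡ contractEdge e G)

-- Outcome classes (normal play): N = next player wins, P = previous player wins.
mutual
  data IsN (G : Graph) : Set where
    winningMove : (H : Graph) → Move G H → IsP H → IsN G

  data IsP (G : Graph) : Set where
    allMovesLose : ((H : Graph) → Move G H → IsN H) → IsP G

data Reach (E : Graph) : ℕ → ℕ → Set where
  here : ∀ {a} → Reach E a a
  step : ∀ {a b c} → Adj E a b → Reach E b c → Reach E a c

removeVertex : ℕ → Graph → Graph
removeVertex x H = filter (λ e → ¬? (incident? x e)) H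

Connected : Graph → Set
Connected H = ∀ a b → IsVertex H a → IsVertex H b → Reach H a b

Biconnected : Graph → Set
Biconnected H =
  (∃[ a ] ∃[ b ] ∃[ c ] IsVertex H a × IsVertex H b × IsVertex H c
       × a ≢ b × b ≢ c × a ≢ c)
  × Connected H
  × (∀ x a b → IsVertex H a → IsVertex H b → a ≢ x → b ≢ x
       → Reach (removeVertex x H) a b)

_⊑_ : Graph → Graph → Set
H ⊑ K = ∀ x y → Adj H x y → Adj K x y

triangle : ℕ → ℕ → ℕ → Graph
triangle a b c = (a , b) ∷ (b , c) ∷ (a , c) ∷ []

TriangleBlock : Graph → ℕ → ℕ → ℕ → Set
TriangleBlock G a b c =
  a ≢ b × b ≢ c × a ≢ c
  × triangle a b c ⊑ G
  × (∀ H → H ⊑ G → triangle a b c ⊑ H → Biconnected H → H ⊑ triangle a b c)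

PropertyS : Graph → Set
PropertyS G =
  (∀ u v → (u , v) ∈ G → ¬ (2 < degree G u × 2 < degree G v))
  × (∀ a b c → ¬ TriangleBlock G a b c)

Even : ℕ → Set
Even n = ∃[ k ] n ≡ 2 * k

-- Property S forces every edge to have an endpoint with at most two
-- neighbours, and it excludes triangles, since a triangle with two such
-- corners is a block.  Call such simple graphs admissible.  Deleting an
-- edge keeps a graph admissible; and as there are no triangles,
-- contracting uv creates no parallel edges, so G/uv is G − uv with v
-- renamed to u.  Let s be the endpoint of uv with at most two
-- neighbours.  If uv is the only edge at s, the renaming is injective on
-- G − uv and G/uv is admissible with one edge fewer; otherwise the reply
-- deleting the image of the other edge at s leaves a copy of an
-- admissible graph with two edges fewer.  Induction on the number of
-- edges now shows that admissible graphs with an even number of edges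
-- are P-positions and those with an odd number are N-positions.
module Submission where

open import Defs
open import Data.Nat using (ℕ; zero; suc; _*_; _<_; _≤_; _≤?_; _≟_; _<?_; z≤n; s≤s)
open import Data.Nat.Properties using (*-suc; suc-injective; ≤∧≢⇒<; ≰⇒>; m≤n⇒m≤1+n; <-asym; <-irrefl)
open import Data.Product using (Σ; ∃; ∃-syntax; _×_; _,_; proj₁; proj₂)
open import Data.Product.Properties using (,-injective)
open import Data.Sum using (_⊎_; inj₁; inj₂)
open import Data.Empty using (⊥; ⊥-elim)
open import Data.List using (List; []; _∷_; length; filter; map; deduplicate)
open import Data.List.Properties using (filter-accept; filter-reject; filter-all; length-map)
open import Data.List.Membership.Propositional using (_∈_)
open import Data.List.Membership.Propositional.Properties using (∈-map⁻; ∈-map⁺; ∈-filter⁺; ∈-filter⁻)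
open import Data.List.Relation.Unary.Any using (here; there)
open import Data.List.Relation.Unary.All using (All; tabulate) renaming (lookup to lookupᴬ; map to mapᴬ)
open import Data.List.Relation.Unary.AllPairs using ([]; _∷_)
open import Data.List.Relation.Unary.Unique.Propositional using (Unique)
open import Data.List.Relation.Unary.Unique.Propositional.Properties using (filter⁺)
open import Function using (_∘_)
open import Relation.Nullary using (¬_; Dec; yes; no; ¬?)
open import Relation.Binary.PropositionalEquality using (_≡_; _≢_; refl; sym; trans; cong; subst; ≢-sym)

even-or-odd : ∀ n → Even n ⊎ ∃[ k ] n ≡ suc (2 * k)
even-or-odd zero = inj₁ (0 , refl)
even-or-odd (suc n) with even-or-odd n
... | inj₁ (k , n≡2k)   = inj₂ (k , cong suc n≡2k)
... | inj₂ (k , n≡2k+1) = inj₁ (suc k , trans (cong suc n≡2k+1) (sym (*-suc 2 k)))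

N⇒¬P : ∀ {G} → IsN G → ¬ IsP G
N⇒¬P (winningMove H G→H P-H) (allMovesLose N-moves) = N⇒¬P (N-moves H G→H) P-H

module _ {A : Set} where

  1≤length : ∀ {x : A} {xs} → x ∈ xs → 1 ≤ length xs
  1≤length (here _)  = s≤s z≤n
  1≤length (there _) = s≤s z≤n

  2≤length : ∀ {x y : A} {xs} → x ∈ xs → y ∈ xs → x ≢ y → 2 ≤ length xs
  2≤length (here refl) (here refl) x≢y = ⊥-elim (x≢y refl)
  2≤length (here _)    (there y∈)  _   = s≤s (1≤length y∈)
  2≤length (there x∈)  (here _)    _   = s≤s (1≤length x∈)
  2≤length (there x∈)  (there y∈)  x≢y = m≤n⇒m≤1+n (2≤length x∈ y∈ x≢y)

  3≤length : ∀ {x y z : A} {xs} → x ∈ xs → y ∈ xs → z ∈ xs → x ≢ y → y ≢ z → x ≢ z → 3 ≤ length xs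
  3≤length (here refl) (here refl) _           x≢y _   _   = ⊥-elim (x≢y refl)
  3≤length (here refl) (there _)   (here refl) _   _   x≢z = ⊥-elim (x≢z refl)
  3≤length (there _)   (here refl) (here refl) _   y≢z _   = ⊥-elim (y≢z refl)
  3≤length (here _)    (there y∈)  (there z∈)  _   y≢z _   = s≤s (2≤length y∈ z∈ y≢z)
  3≤length (there x∈)  (here _)    (there z∈)  _   _   x≢z = s≤s (2≤length x∈ z∈ x≢z)
  3≤length (there x∈)  (there y∈)  (here _)    x≢y _   _   = s≤s (2≤length x∈ y∈ x≢y)
  3≤length (there x∈)  (there y∈)  (there z∈)  x≢y y≢z x≢z = m≤n⇒m≤1+n (3≤length x∈ y∈ z∈ x≢y y≢z x≢z)

module _ {A B : Set} where

  filter-map-comm : ∀ {P : B → Set} {Q : A → Set} (P? : ∀ b → Dec (P b)) (Q? : ∀ a → Dec (Q a))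
    (f : A → B) (xs : List A) → (∀ {x} → x ∈ xs → (P (f x) → Q x) × (Q x → P (f x)))
    → filter P? (map f xs) ≡ map f (filter Q? xs)
  filter-map-comm P? Q? f [] _ = refl
  filter-map-comm P? Q? f (x ∷ xs) P⇔Q with P? (f x)
  ... | yes Pfx = trans (cong (f x ∷_) (filter-map-comm P? Q? f xs (P⇔Q ∘ there)))
                        (sym (cong (map f) (filter-accept Q? (proj₁ (P⇔Q (here refl)) Pfx))))
  ... | no ¬Pfx = trans (filter-map-comm P? Q? f xs (P⇔Q ∘ there))
                        (sym (cong (map f) (filter-reject Q? (¬Pfx ∘ proj₂ (P⇔Q (here refl))))))

  map⁺-injectiveOn : (f : A → B) {xs : List A} → Unique xs
    → (∀ {x y} → x ∈ xs → y ∈ xs → f x ≡ f y → x ≡ y) → Unique (map f xs)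
  map⁺-injectiveOn f {[]} _ _ = []
  map⁺-injectiveOn f {x ∷ xs} (x∉xs ∷ xs!) inj =
    tabulate (λ fy∈ fx≡fy → let (y , y∈ , fy≡) = ∈-map⁻ f fy∈ in
                             lookupᴬ x∉xs y∈ (inj (here refl) (there y∈) (trans fx≡fy fy≡)))
    ∷ map⁺-injectiveOn f xs! (λ x∈ y∈ → inj (there x∈) (there y∈))

deduplicate-Unique : ∀ {G : Graph} → Unique G → deduplicate _≟ₑ_ G ≡ G
deduplicate-Unique {[]} _ = refl
deduplicate-Unique {e ∷ G} (e∉G ∷ G!) =
  cong (e ∷_) (trans (cong (filter _) (deduplicate-Unique G!)) (filter-all _ e∉G))

differs? : (e f : Edge) → Dec (f ≢ e)
differs? e f = ¬? (f ≟ₑ e)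

length-deleteEdge : ∀ {G e} → Unique G → e ∈ G → suc (length (deleteEdge e G)) ≡ length G
length-deleteEdge {e ∷ G} (e∉G ∷ _) (here refl) =
  cong (suc ∘ length) (trans (filter-reject (differs? e) (λ e≢e → e≢e refl))
                             (filter-all (differs? e) (mapᴬ ≢-sym e∉G)))
length-deleteEdge {f ∷ G} (f∉G ∷ G!) (there e∈G) =
  trans (cong (suc ∘ length) (filter-accept (differs? _) (lookupᴬ f∉G e∈G)))
        (cong suc (length-deleteEdge G! e∈G))

∈-deleteEdge⁻ : ∀ {G e f} → f ∈ deleteEdge e G → f ∈ G × f ≢ e
∈-deleteEdge⁻ {e = e} = ∈-filter⁻ (differs? e)

Oriented : Graph → Set
Oriented G = All (λ e → proj₁ e < proj₂ e) G

TriangleFree : Graph → Set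
TriangleFree G = ∀ a b c → Adj G a b → Adj G b c → Adj G a c → ⊥

AtMostTwoNeighbours : Graph → ℕ → Set
AtMostTwoNeighbours G z = ∀ p q r → Adj G z p → Adj G z q → Adj G z r → p ≡ q ⊎ q ≡ r ⊎ p ≡ r

-- Unlike property S, admissibility survives deletions and injective
-- renamings of vertices.
record Admissible (G : Graph) : Set where
  field
    oriented      : Oriented G
    unique        : Unique G
    triangle-free : TriangleFree G
    low-end       : ∀ x y → (x , y) ∈ G → AtMostTwoNeighbours G x ⊎ AtMostTwoNeighbours G y
open Admissible

Adj-sym : ∀ {G x y} → Adj G x y → Adj G y x
Adj-sym (inj₁ xy∈) = inj₂ xy∈
Adj-sym (inj₂ yx∈) = inj₁ yx∈

Adj⇒IsVertexˡ : ∀ {G x y} → Adj G x y → IsVertex G x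
Adj⇒IsVertexˡ {y = y} x~y = y , x~y

Adj⇒IsVertexʳ : ∀ {G x y} → Adj G x y → IsVertex G y
Adj⇒IsVertexʳ {x = x} x~y = x , Adj-sym x~y

Adj-⊆ : ∀ {G L} → (∀ {e} → e ∈ L → e ∈ G) → ∀ {x y} → Adj L x y → Adj G x y
Adj-⊆ L⊆G (inj₁ xy∈) = inj₁ (L⊆G xy∈)
Adj-⊆ L⊆G (inj₂ yx∈) = inj₂ (L⊆G yx∈)

¬Adj-refl : ∀ {G x} → Oriented G → ¬ Adj G x x
¬Adj-refl o (inj₁ xx∈) = <-irrefl refl (lookupᴬ o xx∈)
¬Adj-refl o (inj₂ xx∈) = <-irrefl refl (lookupᴬ o xx∈)

Adj⇒≢ : ∀ {G x y} → Oriented G → Adj G x y → x ≢ y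
Adj⇒≢ o x~y refl = ¬Adj-refl o x~y

Joins : ℕ → ℕ → ℕ → ℕ → Set
Joins u v a b = (a ≡ u × b ≡ v) ⊎ (a ≡ v × b ≡ u)

joins⇒≡ : ∀ {G a b c d} → Oriented G → (a , b) ∈ G → (c , d) ∈ G → Joins c d a b → (a , b) ≡ (c , d)
joins⇒≡ o _     _     (inj₁ (refl , refl)) = refl
joins⇒≡ o ab∈G ba∈G (inj₂ (refl , refl)) = ⊥-elim (<-asym (lookupᴬ o ab∈G) (lookupᴬ o ba∈G))

Admissible-⊆ : ∀ {G L} → (∀ {e} → e ∈ L → e ∈ G) → Unique L → Admissible G → Admissible L
Admissible-⊆ {G} {L} L⊆G L! adm = record
  { oriented      = tabulate (lookupᴬ (oriented adm) ∘ L⊆G)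
  ; unique        = L!
  ; triangle-free = λ a b c ab bc ac → triangle-free adm a b c (lift ab) (lift bc) (lift ac)
  ; low-end       = λ x y xy∈ → restrict (low-end adm x y (L⊆G xy∈))
  }
  where
  lift : ∀ {x y} → Adj L x y → Adj G x y
  lift = Adj-⊆ L⊆G
  few : ∀ {z} → AtMostTwoNeighbours G z → AtMostTwoNeighbours L z
  few few-z p q r zp zq zr = few-z p q r (lift zp) (lift zq) (lift zr)
  restrict : ∀ {x y} → AtMostTwoNeighbours G x ⊎ AtMostTwoNeighbours G y
    → AtMostTwoNeighbours L x ⊎ AtMostTwoNeighbours L y
  restrict (inj₁ few-x) = inj₁ (few few-x)
  restrict (inj₂ few-y) = inj₂ (few few-y)

Admissible-deleteEdge : ∀ {G e} → Admissible G → Admissible (deleteEdge e G)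
Admissible-deleteEdge {e = e} adm = Admissible-⊆ (proj₁ ∘ ∈-deleteEdge⁻) (filter⁺ (differs? e) (unique adm)) adm

Loop : Edge → Set
Loop e = proj₁ e ≡ proj₂ e

normalise-cases : ∀ p q → normalise (p , q) ≡ (p , q) ⊎ normalise (p , q) ≡ (q , p)
normalise-cases p q with p ≤? q
... | yes _ = inj₁ refl
... | no _  = inj₂ refl

normalise-< : ∀ p q → p ≢ q → proj₁ (normalise (p , q)) < proj₂ (normalise (p , q))
normalise-< p q p≢q with p ≤? q
... | yes p≤q = ≤∧≢⇒< p≤q p≢q
... | no p≰q  = ≰⇒> p≰q

normalise-injective : ∀ p q p′ q′ → normalise (p , q) ≡ normalise (p′ , q′) → Joins p′ q′ p q
normalise-injective p q p′ q′ eq with normalise-cases p q | normalise-cases p′ q′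
... | inj₁ n≡ | inj₁ n′≡ = inj₁ (,-injective (trans (sym n≡) (trans eq n′≡)))
... | inj₁ n≡ | inj₂ n′≡ = inj₂ (,-injective (trans (sym n≡) (trans eq n′≡)))
... | inj₂ n≡ | inj₁ n′≡ = let (q≡p′ , p≡q′) = ,-injective (trans (sym n≡) (trans eq n′≡)) in inj₂ (p≡q′ , q≡p′)
... | inj₂ n≡ | inj₂ n′≡ = let (q≡q′ , p≡p′) = ,-injective (trans (sym n≡) (trans eq n′≡)) in inj₁ (p≡p′ , q≡q′)

normalise-loop⁻ : ∀ p q → Loop (normalise (p , q)) → p ≡ q
normalise-loop⁻ p q eq with p ≤? q
... | yes _ = eq
... | no _  = sym eq

normalise-loop : ∀ p → Loop (normalise (p , p))
normalise-loop p with p ≤? p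
... | yes _ = refl
... | no _  = refl

relabelEdge : (ℕ → ℕ) → Edge → Edge
relabelEdge ρ e = normalise (ρ (proj₁ e) , ρ (proj₂ e))

Adj-relabel⁻ : ∀ ρ L {p q} → Adj (map (relabelEdge ρ) L) p q → ∃[ a ] ∃[ b ] Adj L a b × ρ a ≡ p × ρ b ≡ q
Adj-relabel⁻ ρ L (inj₁ pq∈) = edge⁻ pq∈
  where
  edge⁻ : ∀ {p q} → (p , q) ∈ map (relabelEdge ρ) L → ∃[ a ] ∃[ b ] Adj L a b × ρ a ≡ p × ρ b ≡ q
  edge⁻ pq∈ with ∈-map⁻ (relabelEdge ρ) pq∈
  ... | ((a , b) , ab∈ , pq≡) with normalise-cases (ρ a) (ρ b)
  ...   | inj₁ n≡ = let (p≡ , q≡) = ,-injective (trans pq≡ n≡) in a , b , inj₁ ab∈ , sym p≡ , sym q≡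
  ...   | inj₂ n≡ = let (p≡ , q≡) = ,-injective (trans pq≡ n≡) in b , a , inj₂ ab∈ , sym p≡ , sym q≡
Adj-relabel⁻ ρ L (inj₂ qp∈) with Adj-relabel⁻ ρ L (inj₁ qp∈)
... | (a , b , a~b , ρa≡q , ρb≡p) = b , a , Adj-sym a~b , ρb≡p , ρa≡q

InjectiveOnVertices : (ℕ → ℕ) → Graph → Set
InjectiveOnVertices ρ L = ∀ x y → IsVertex L x → IsVertex L y → ρ x ≡ ρ y → x ≡ y

module Relabel (ρ : ℕ → ℕ) (L : Graph) (adm : Admissible L) (inj : InjectiveOnVertices ρ L) where

  K : Graph
  K = map (relabelEdge ρ) L

  private
    inj-Adj : ∀ {a b c d} → Adj L a b → Adj L c d → ρ a ≡ ρ c → ρ b ≡ ρ d → a ≡ c × b ≡ d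
    inj-Adj a~b c~d ρa≡ρc ρb≡ρd =
      inj _ _ (Adj⇒IsVertexˡ a~b) (Adj⇒IsVertexˡ c~d) ρa≡ρc , inj _ _ (Adj⇒IsVertexʳ a~b) (Adj⇒IsVertexʳ c~d) ρb≡ρd

  oriented′ : Oriented K
  oriented′ = tabulate λ e∈ → orient (∈-map⁻ (relabelEdge ρ) e∈)
    where
    orient : ∀ {e} → ∃ (λ g → g ∈ L × e ≡ relabelEdge ρ g) → proj₁ e < proj₂ e
    orient ((a , b) , ab∈ , refl) = normalise-< (ρ a) (ρ b) λ ρa≡ρb →
      <-irrefl (inj a b (Adj⇒IsVertexˡ (inj₁ ab∈)) (Adj⇒IsVertexʳ (inj₁ ab∈)) ρa≡ρb) (lookupᴬ (oriented adm) ab∈)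

  unique′ : Unique K
  unique′ = map⁺-injectiveOn (relabelEdge ρ) (unique adm) edge-inj
    where
    edge-inj : ∀ {g h} → g ∈ L → h ∈ L → relabelEdge ρ g ≡ relabelEdge ρ h → g ≡ h
    edge-inj {a , b} {c , d} ab∈ cd∈ eq with normalise-injective (ρ a) (ρ b) (ρ c) (ρ d) eq
    ... | inj₁ (ρa≡ρc , ρb≡ρd) = joins⇒≡ (oriented adm) ab∈ cd∈ (inj₁ (inj-Adj (inj₁ ab∈) (inj₁ cd∈) ρa≡ρc ρb≡ρd))
    ... | inj₂ (ρa≡ρd , ρb≡ρc) = joins⇒≡ (oriented adm) ab∈ cd∈ (inj₂ (inj-Adj (inj₁ ab∈) (inj₂ cd∈) ρa≡ρd ρb≡ρc))

  triangle-free′ : TriangleFree K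
  triangle-free′ p q r p~q q~r p~r
    with Adj-relabel⁻ ρ L p~q | Adj-relabel⁻ ρ L q~r | Adj-relabel⁻ ρ L p~r
  ... | (a , b , a~b , ρa , ρb) | (b′ , c , b′~c , ρb′ , ρc) | (a′ , c′ , a′~c′ , ρa′ , ρc′)
    with inj b b′ (Adj⇒IsVertexʳ a~b) (Adj⇒IsVertexˡ b′~c) (trans ρb (sym ρb′))
       | inj a a′ (Adj⇒IsVertexˡ a~b) (Adj⇒IsVertexˡ a′~c′) (trans ρa (sym ρa′))
       | inj c c′ (Adj⇒IsVertexʳ b′~c) (Adj⇒IsVertexʳ a′~c′) (trans ρc (sym ρc′))
  ... | refl | refl | refl = triangle-free adm a b c a~b b′~c a′~c′

  private
    few-image : ∀ z → IsVertex L z → AtMostTwoNeighbours L z → AtMostTwoNeighbours K (ρ z)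
    few-image z z∈ few p q r z~p z~q z~r
      with Adj-relabel⁻ ρ L z~p | Adj-relabel⁻ ρ L z~q | Adj-relabel⁻ ρ L z~r
    ... | (a₁ , c₁ , a₁~c₁ , ρa₁ , refl) | (a₂ , c₂ , a₂~c₂ , ρa₂ , refl) | (a₃ , c₃ , a₃~c₃ , ρa₃ , refl)
      with inj a₁ z (Adj⇒IsVertexˡ a₁~c₁) z∈ ρa₁ | inj a₂ z (Adj⇒IsVertexˡ a₂~c₂) z∈ ρa₂
         | inj a₃ z (Adj⇒IsVertexˡ a₃~c₃) z∈ ρa₃
    ... | refl | refl | refl with few c₁ c₂ c₃ a₁~c₁ a₂~c₂ a₃~c₃
    ...   | inj₁ eq        = inj₁ (cong ρ eq)
    ...   | inj₂ (inj₁ eq) = inj₂ (inj₁ (cong ρ eq))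
    ...   | inj₂ (inj₂ eq) = inj₂ (inj₂ (cong ρ eq))

    low-end-image : ∀ {a b} → (a , b) ∈ L → ∀ {p q} → (p , q) ≡ normalise (ρ a , ρ b)
      → AtMostTwoNeighbours K p ⊎ AtMostTwoNeighbours K q
    low-end-image {a} {b} ab∈ pq≡ with normalise-cases (ρ a) (ρ b) | low-end adm a b ab∈
    ... | inj₁ n≡ | inj₁ few-a with ,-injective (trans pq≡ n≡)
    ...   | (refl , _) = inj₁ (few-image a (Adj⇒IsVertexˡ (inj₁ ab∈)) few-a)
    low-end-image ab∈ pq≡ | inj₁ n≡ | inj₂ few-b with ,-injective (trans pq≡ n≡)
    ...   | (_ , refl) = inj₂ (few-image _ (Adj⇒IsVertexʳ (inj₁ ab∈)) few-b)
    low-end-image ab∈ pq≡ | inj₂ n≡ | inj₁ few-a with ,-injective (trans pq≡ n≡)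
    ...   | (_ , refl) = inj₂ (few-image _ (Adj⇒IsVertexˡ (inj₁ ab∈)) few-a)
    low-end-image ab∈ pq≡ | inj₂ n≡ | inj₂ few-b with ,-injective (trans pq≡ n≡)
    ...   | (refl , _) = inj₁ (few-image _ (Adj⇒IsVertexʳ (inj₁ ab∈)) few-b)

  admissible : Admissible K
  admissible = record
    { oriented      = oriented′
    ; unique        = unique′
    ; triangle-free = triangle-free′
    ; low-end       = λ p q pq∈ → let (_ , ab∈ , pq≡) = ∈-map⁻ (relabelEdge ρ) pq∈ in low-end-image ab∈ pq≡
    }

renameV-cases : ∀ u v x y → renameV u v x ≡ renameV u v y → x ≡ y ⊎ Joins u v x y
renameV-cases u v x y eq with x ≟ v | y ≟ v
... | yes x≡v | yes y≡v = inj₁ (trans x≡v (sym y≡v))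
... | yes x≡v | no _    = inj₂ (inj₂ (x≡v , sym eq))
... | no _    | yes y≡v = inj₂ (inj₁ (eq , y≡v))
... | no _    | no _    = inj₁ eq

renameV-fixed : ∀ u v x → x ≢ v → renameV u v x ≡ x
renameV-fixed u v x x≢v with x ≟ v
... | yes x≡v = ⊥-elim (x≢v x≡v)
... | no _    = refl

renameV-merged : ∀ u v → renameV u v v ≡ u
renameV-merged u v with v ≟ v
... | yes _   = refl
... | no v≢v = ⊥-elim (v≢v refl)

renameV-injective-off : ∀ {u v s} → Incident s (u , v)
  → ∀ {x y} → x ≢ s → y ≢ s → renameV u v x ≡ renameV u v y → x ≡ y
renameV-injective-off {u} {v} (inj₁ refl) {x} {y} x≢u y≢u eq with renameV-cases u v x y eq
... | inj₁ x≡y              = x≡y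
... | inj₂ (inj₁ (x≡u , _)) = ⊥-elim (x≢u x≡u)
... | inj₂ (inj₂ (_ , y≡u)) = ⊥-elim (y≢u y≡u)
renameV-injective-off {u} {v} (inj₂ refl) {x} {y} x≢v y≢v eq with renameV-cases u v x y eq
... | inj₁ x≡y              = x≡y
... | inj₂ (inj₁ (_ , y≡v)) = ⊥-elim (y≢v y≡v)
... | inj₂ (inj₂ (x≡v , _)) = ⊥-elim (x≢v x≡v)

module Contraction (G : Graph) (adm : Admissible G) {u v : ℕ} (uv∈G : (u , v) ∈ G) where

  ρ : ℕ → ℕ
  ρ = renameV u v

  G-uv : Graph
  G-uv = deleteEdge (u , v) G

  unique-G-uv : Unique G-uv
  unique-G-uv = filter⁺ (differs? (u , v)) (unique adm)

  private
    u~v : Adj G u v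
    u~v = inj₁ uv∈G

    u<v : u < v
    u<v = lookupᴬ (oriented adm) uv∈G

    △ : TriangleFree G
    △ = triangle-free adm

  -- Two edges with equal images that differ in one end would form a triangle with uv.
  renamed-ends-injective : ∀ {a b c d} → Adj G a b → Adj G c d → ¬ Joins u v a b
    → ρ a ≡ ρ c → ρ b ≡ ρ d → a ≡ c × b ≡ d
  renamed-ends-injective {a} {b} {c} {d} a~b c~d ¬uv ρa≡ρc ρb≡ρd
    with renameV-cases u v a c ρa≡ρc | renameV-cases u v b d ρb≡ρd
  ... | inj₁ refl                 | inj₁ refl                 = refl , refl
  ... | inj₁ refl                 | inj₂ (inj₁ (refl , refl)) = ⊥-elim (△ a u v a~b u~v c~d)
  ... | inj₁ refl                 | inj₂ (inj₂ (refl , refl)) = ⊥-elim (△ a v u a~b (Adj-sym u~v) c~d)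
  ... | inj₂ (inj₁ (refl , refl)) | inj₁ refl                 = ⊥-elim (△ b u v (Adj-sym a~b) u~v (Adj-sym c~d))
  ... | inj₂ (inj₂ (refl , refl)) | inj₁ refl                 = ⊥-elim (△ b v u (Adj-sym a~b) (Adj-sym u~v) (Adj-sym c~d))
  ... | inj₂ (inj₁ (refl , refl)) | inj₂ (inj₁ (refl , refl)) = ⊥-elim (¬Adj-refl (oriented adm) a~b)
  ... | inj₂ (inj₁ (refl , refl)) | inj₂ (inj₂ (refl , refl)) = ⊥-elim (¬uv (inj₁ (refl , refl)))
  ... | inj₂ (inj₂ (refl , refl)) | inj₂ (inj₁ (refl , refl)) = ⊥-elim (¬uv (inj₂ (refl , refl)))
  ... | inj₂ (inj₂ (refl , refl)) | inj₂ (inj₂ (refl , refl)) = ⊥-elim (¬Adj-refl (oriented adm) a~b)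

  ¬Joins : ∀ {a b} → (a , b) ∈ G → (a , b) ≢ (u , v) → ¬ Joins u v a b
  ¬Joins ab∈G ab≢uv (inj₁ (refl , refl)) = ab≢uv refl
  ¬Joins ab∈G ab≢uv (inj₂ (refl , refl)) = <-asym u<v (lookupᴬ (oriented adm) ab∈G)

  relabel-injectiveOn : ∀ {g h} → g ∈ G-uv → h ∈ G-uv → relabelEdge ρ g ≡ relabelEdge ρ h → g ≡ h
  relabel-injectiveOn {a , b} {c , d} ab∈ cd∈ eq
    with ∈-deleteEdge⁻ ab∈ | ∈-deleteEdge⁻ cd∈ | normalise-injective (ρ a) (ρ b) (ρ c) (ρ d) eq
  ... | (ab∈G , ab≢uv) | (cd∈G , _) | inj₁ (ρa≡ρc , ρb≡ρd) = joins⇒≡ (oriented adm) ab∈G cd∈G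
    (inj₁ (renamed-ends-injective (inj₁ ab∈G) (inj₁ cd∈G) (¬Joins ab∈G ab≢uv) ρa≡ρc ρb≡ρd))
  ... | (ab∈G , ab≢uv) | (cd∈G , _) | inj₂ (ρa≡ρd , ρb≡ρc) = joins⇒≡ (oriented adm) ab∈G cd∈G
    (inj₂ (renamed-ends-injective (inj₁ ab∈G) (inj₂ cd∈G) (¬Joins ab∈G ab≢uv) ρa≡ρd ρb≡ρc))

  relabel-loop-iff-uv : ∀ {g} → g ∈ G
    → (¬ Loop (relabelEdge ρ g) → g ≢ (u , v)) × (g ≢ (u , v) → ¬ Loop (relabelEdge ρ g))
  relabel-loop-iff-uv {a , b} ab∈G =
    (λ { ¬loop refl → ¬loop uv-loop }) ,
    (λ ab≢uv loop → ¬Joins ab∈G ab≢uv (ends (renameV-cases u v a b (normalise-loop⁻ (ρ a) (ρ b) loop))))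
    where
    uv-loop : Loop (relabelEdge ρ (u , v))
    uv-loop rewrite renameV-fixed u v u (λ u≡v → <-irrefl u≡v u<v) | renameV-merged u v = normalise-loop u
    ends : a ≡ b ⊎ Joins u v a b → Joins u v a b
    ends (inj₁ refl) = ⊥-elim (<-irrefl refl (lookupᴬ (oriented adm) ab∈G))
    ends (inj₂ uv)   = uv

  -- Triangle-freeness makes the deduplication step of the contraction trivial.
  contractEdge≡relabel : contractEdge (u , v) G ≡ map (relabelEdge ρ) G-uv
  contractEdge≡relabel =
    trans (cong (deduplicate _≟ₑ_)
                (filter-map-comm notLoop? (differs? (u , v)) (relabelEdge ρ) G relabel-loop-iff-uv))
          (deduplicate-Unique (map⁺-injectiveOn (relabelEdge ρ) unique-G-uv relabel-injectiveOn))

Between : ℕ → ℕ → Edge → Set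
Between s w g = g ≡ (s , w) ⊎ g ≡ (w , s)

incident⇒Between : ∀ {G g s} → g ∈ G → Incident s g → ∃[ w ] Adj G s w × Between s w g
incident⇒Between {g = a , b} ab∈G (inj₁ refl) = b , inj₁ ab∈G , inj₁ refl
incident⇒Between {g = a , b} ab∈G (inj₂ refl) = a , inj₂ ab∈G , inj₂ refl

Between-unique : ∀ {G g h s w} → Oriented G → g ∈ G → h ∈ G → Between s w g → Between s w h → g ≡ h
Between-unique o g∈G h∈G (inj₁ refl) (inj₁ refl) = refl
Between-unique o g∈G h∈G (inj₂ refl) (inj₂ refl) = refl
Between-unique o g∈G h∈G (inj₁ refl) (inj₂ refl) = ⊥-elim (<-asym (lookupᴬ o g∈G) (lookupᴬ o h∈G))
Between-unique o g∈G h∈G (inj₂ refl) (inj₁ refl) = ⊥-elim (<-asym (lookupᴬ o g∈G) (lookupᴬ o h∈G))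

at-most-two-edges-at : ∀ {G s g₁ g₂ g₃} → Oriented G → AtMostTwoNeighbours G s
  → g₁ ∈ G → g₂ ∈ G → g₃ ∈ G → Incident s g₁ → Incident s g₂ → Incident s g₃
  → g₁ ≢ g₂ → g₂ ≢ g₃ → g₁ ≢ g₃ → ⊥
at-most-two-edges-at o few g₁∈ g₂∈ g₃∈ s∈g₁ s∈g₂ s∈g₃ g₁≢g₂ g₂≢g₃ g₁≢g₃
  with incident⇒Between g₁∈ s∈g₁ | incident⇒Between g₂∈ s∈g₂ | incident⇒Between g₃∈ s∈g₃
... | (w₁ , s~w₁ , b₁) | (w₂ , s~w₂ , b₂) | (w₃ , s~w₃ , b₃) with few w₁ w₂ w₃ s~w₁ s~w₂ s~w₃
... | inj₁ refl        = g₁≢g₂ (Between-unique o g₁∈ g₂∈ b₁ b₂)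
... | inj₂ (inj₁ refl) = g₂≢g₃ (Between-unique o g₂∈ g₃∈ b₂ b₃)
... | inj₂ (inj₂ refl) = g₁≢g₃ (Between-unique o g₁∈ g₃∈ b₁ b₃)

other-edge-at? : ∀ s e (G : Graph)
  → (Σ Edge λ g → g ∈ G × Incident s g × g ≢ e) ⊎ (∀ {g} → g ∈ G → Incident s g → g ≡ e)
other-edge-at? s e [] = inj₂ λ ()
other-edge-at? s e (g ∷ G) with incident? s g | g ≟ₑ e | other-edge-at? s e G
... | yes s∈g | no g≢e  | _                            = inj₁ (g , here refl , s∈g , g≢e)
... | _       | _        | inj₁ (h , h∈G , s∈h , h≢e) = inj₁ (h , there h∈G , s∈h , h≢e)
... | yes s∈g | yes g≡e | inj₂ only-e =
  inj₂ λ { (here refl) _ → g≡e ; (there h∈G) s∈h → only-e h∈G s∈h }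
... | no s∉g  | _        | inj₂ only-e =
  inj₂ λ { (here refl) s∈g → ⊥-elim (s∉g s∈g) ; (there h∈G) s∈h → only-e h∈G s∈h }

deleteEdge-shortens : ∀ {G e n} → Unique G → e ∈ G → length G ≡ suc n → length (deleteEdge e G) ≡ n
deleteEdge-shortens G! e∈G len = suc-injective (trans (length-deleteEdge G! e∈G) len)

AllP AllN : ℕ → Set
AllP n = ∀ G → Admissible G → length G ≡ n → IsP G
AllN n = ∀ G → Admissible G → length G ≡ n → IsN G

module ContractionAt (G : Graph) (adm : Admissible G) {u v : ℕ} (uv∈G : (u , v) ∈ G)
                     {s : ℕ} (s∈uv : Incident s (u , v)) (few : AtMostTwoNeighbours G s) where
  open Contraction G adm uv∈G

  relabel-avoiding : ∀ {L} → (∀ {g} → g ∈ L → g ∈ G) → Unique L → (∀ {g} → g ∈ L → ¬ Incident s g)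
    → Admissible (map (relabelEdge ρ) L)
  relabel-avoiding {L} L⊆G L! s∉L =
    Relabel.admissible ρ L (Admissible-⊆ L⊆G L! adm) λ x y x∈ y∈ → renameV-injective-off s∈uv (avoid x∈) (avoid y∈)
    where
    avoid : ∀ {x} → IsVertex L x → x ≢ s
    avoid (_ , inj₁ xy∈) refl = s∉L xy∈ (inj₁ refl)
    avoid (_ , inj₂ yx∈) refl = s∉L yx∈ (inj₂ refl)

  sole-edge-at-s : (∀ {g} → g ∈ G → Incident s g → g ≡ (u , v))
    → ∀ {m} → length G ≡ suc m → AllN m → IsN (map (relabelEdge ρ) G-uv)
  sole-edge-at-s only-uv len allN =
    allN _ (relabel-avoiding (proj₁ ∘ ∈-deleteEdge⁻) unique-G-uv s∉G-uv)
           (trans (length-map (relabelEdge ρ) G-uv) (deleteEdge-shortens (unique adm) uv∈G len))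
    where
    s∉G-uv : ∀ {g} → g ∈ G-uv → ¬ Incident s g
    s∉G-uv g∈ s∈g = let (g∈G , g≢uv) = ∈-deleteEdge⁻ g∈ in g≢uv (only-uv g∈G s∈g)

  second-edge-at-s : ∀ {g} → g ∈ G-uv → Incident s g
    → ∀ {k} → length G ≡ suc (suc k) → AllP k → IsN (map (relabelEdge ρ) G-uv)
  second-edge-at-s {g} g∈ s∈g {k} len allP =
    winningMove _ (f g , ∈-map⁺ f g∈ , inj₁ refl) (subst IsP (sym reply≡) (allP _ admissible-rest length-rest))
    where
    f : Edge → Edge
    f = relabelEdge ρ
    rest : Graph
    rest = deleteEdge g G-uv
    reply≡ : deleteEdge (f g) (map f G-uv) ≡ map f rest
    reply≡ = filter-map-comm (differs? (f g)) (differs? g) f G-uv λ h∈ →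
      (λ fh≢fg h≡g → fh≢fg (cong f h≡g)) , (λ h≢g fh≡fg → h≢g (relabel-injectiveOn h∈ g∈ fh≡fg))
    s∉rest : ∀ {h} → h ∈ rest → ¬ Incident s h
    s∉rest h∈ s∈h with ∈-deleteEdge⁻ h∈
    ... | (h∈G-uv , h≢g) with ∈-deleteEdge⁻ h∈G-uv | ∈-deleteEdge⁻ g∈
    ...   | (h∈G , h≢uv) | (g∈G , g≢uv) =
      at-most-two-edges-at (oriented adm) few h∈G uv∈G g∈G s∈h s∈uv s∈g h≢uv (≢-sym g≢uv) h≢g
    admissible-rest : Admissible (map f rest)
    admissible-rest =
      relabel-avoiding (proj₁ ∘ ∈-deleteEdge⁻ ∘ proj₁ ∘ ∈-deleteEdge⁻) (filter⁺ (differs? g) unique-G-uv) s∉rest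
    length-rest : length (map f rest) ≡ k
    length-rest =
      trans (length-map f rest) (deleteEdge-shortens unique-G-uv g∈ (deleteEdge-shortens (unique adm) uv∈G len))

  contraction-N : ∀ {k} → length G ≡ suc (suc k) → AllN (suc k) → AllP k → IsN (contractEdge (u , v) G)
  contraction-N len allN allP = subst IsN (sym contractEdge≡relabel) (by-cases (other-edge-at? s (u , v) G))
    where
    by-cases : (Σ Edge λ g → g ∈ G × Incident s g × g ≢ (u , v)) ⊎ (∀ {g} → g ∈ G → Incident s g → g ≡ (u , v))
      → IsN (map (relabelEdge ρ) G-uv)
    by-cases (inj₁ (g , g∈G , s∈g , g≢uv)) = second-edge-at-s (∈-filter⁺ (differs? (u , v)) g∈G g≢uv) s∈g len allP
    by-cases (inj₂ only-uv)                = sole-edge-at-s only-uv len allN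

contractEdge-N : ∀ {G u v k} → Admissible G → (u , v) ∈ G → length G ≡ suc (suc k)
  → AllN (suc k) → AllP k → IsN (contractEdge (u , v) G)
contractEdge-N {G} adm uv∈G with low-end adm _ _ uv∈G
... | inj₁ few-u = ContractionAt.contraction-N G adm uv∈G (inj₁ refl) few-u
... | inj₂ few-v = ContractionAt.contraction-N G adm uv∈G (inj₂ refl) few-v

allP-empty : AllP 0
allP-empty []      _ _  = allMovesLose λ { _ (_ , () , _) }
allP-empty (_ ∷ _) _ ()

deleteEdge-P⇒N : ∀ {n} → AllP n → AllN (suc n)
deleteEdge-P⇒N allP []      _   ()
deleteEdge-P⇒N allP (g ∷ G) adm len =
  winningMove _ (g , here refl , inj₁ refl)
    (allP _ (Admissible-deleteEdge adm) (deleteEdge-shortens (unique adm) (here refl) len))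

moves-N⇒P : ∀ {k} → AllN (suc k) → AllP k → AllP (suc (suc k))
moves-N⇒P allN allP G adm len = allMovesLose λ
  { _ (_ , e∈G , inj₁ refl) → allN _ (Admissible-deleteEdge adm) (deleteEdge-shortens (unique adm) e∈G len)
  ; _ (_ , e∈G , inj₂ refl) → contractEdge-N adm e∈G len allN allP
  }

parity-outcome : ∀ k → AllP (2 * k) × AllN (suc (2 * k))
parity-outcome zero    = allP-empty , deleteEdge-P⇒N allP-empty
parity-outcome (suc k) with parity-outcome k
... | (allP , allN) = subst AllP 2+2k≡ allP′ , subst (AllN ∘ suc) 2+2k≡ (deleteEdge-P⇒N allP′)
  where
  2+2k≡ : suc (suc (2 * k)) ≡ 2 * suc k
  2+2k≡ = sym (*-suc 2 k)
  allP′ : AllP (suc (suc (2 * k)))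
  allP′ = moves-N⇒P allN allP

Adj⇒incident-edge : ∀ {G z p} → Adj G z p → ∃ λ e → e ∈ filter (incident? z) G × Between z p e
Adj⇒incident-edge (inj₁ zp∈) = _ , ∈-filter⁺ (incident? _) zp∈ (inj₁ refl) , inj₁ refl
Adj⇒incident-edge (inj₂ pz∈) = _ , ∈-filter⁺ (incident? _) pz∈ (inj₂ refl) , inj₂ refl

Between-injective : ∀ {e z p q} → Between z p e → Between z q e → p ≡ q
Between-injective (inj₁ refl) (inj₁ e≡) = proj₂ (,-injective e≡)
Between-injective (inj₁ refl) (inj₂ e≡) = let (z≡q , p≡z) = ,-injective e≡ in trans p≡z z≡q
Between-injective (inj₂ refl) (inj₁ e≡) = let (p≡z , z≡q) = ,-injective e≡ in trans p≡z z≡q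
Between-injective (inj₂ refl) (inj₂ e≡) = proj₁ (,-injective e≡)

degree≤2⇒AtMostTwoNeighbours : ∀ G z → ¬ (2 < degree G z) → AtMostTwoNeighbours G z
degree≤2⇒AtMostTwoNeighbours G z deg≤2 p q r z~p z~q z~r with p ≟ q | q ≟ r | p ≟ r
... | yes p≡q | _       | _       = inj₁ p≡q
... | no _    | yes q≡r | _       = inj₂ (inj₁ q≡r)
... | no _    | no _    | yes p≡r = inj₂ (inj₂ p≡r)
... | no p≢q  | no q≢r  | no p≢r
  with Adj⇒incident-edge z~p | Adj⇒incident-edge z~q | Adj⇒incident-edge z~r
... | (e₁ , e₁∈ , b₁) | (e₂ , e₂∈ , b₂) | (e₃ , e₃∈ , b₃) = ⊥-elim (deg≤2 (3≤length e₁∈ e₂∈ e₃∈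
      (λ { refl → p≢q (Between-injective b₁ b₂) })
      (λ { refl → q≢r (Between-injective b₂ b₃) })
      (λ { refl → p≢r (Between-injective b₁ b₃) })))

module LowTriangle (G : Graph) (o : Oriented G) {x y z : ℕ}
  (few-x : AtMostTwoNeighbours G x) (few-y : AtMostTwoNeighbours G y)
  (x~y : Adj G x y) (y~z : Adj G y z) (x~z : Adj G x z) where

  Corner : ℕ → Set
  Corner p = p ≡ x ⊎ p ≡ y ⊎ p ≡ z

  corner? : ∀ p → Dec (Corner p)
  corner? p with p ≟ x | p ≟ y | p ≟ z
  ... | yes p≡x | _       | _       = yes (inj₁ p≡x)
  ... | no _    | yes p≡y | _       = yes (inj₂ (inj₁ p≡y))
  ... | no _    | no _    | yes p≡z = yes (inj₂ (inj₂ p≡z))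
  ... | no p≢x  | no p≢y  | no p≢z  =
    no λ { (inj₁ p≡x) → p≢x p≡x ; (inj₂ (inj₁ p≡y)) → p≢y p≡y ; (inj₂ (inj₂ p≡z)) → p≢z p≡z }

  triangle-⊑ : triangle x y z ⊑ G
  triangle-⊑ p q p~q = orient p~q
    where
    edge : ∀ {p q} → (p , q) ∈ triangle x y z → Adj G p q
    edge (here refl)                 = x~y
    edge (there (here refl))         = y~z
    edge (there (there (here refl))) = x~z
    orient : Adj (triangle x y z) p q → Adj G p q
    orient (inj₁ pq∈) = edge pq∈
    orient (inj₂ qp∈) = Adj-sym (edge qp∈)

  corners-Adj : ∀ {p q} → Corner p → Corner q → Adj G p q → Adj (triangle x y z) p q
  corners-Adj (inj₁ refl)        (inj₁ refl)        p~q = ⊥-elim (¬Adj-refl o p~q)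
  corners-Adj (inj₁ refl)        (inj₂ (inj₁ refl)) _   = inj₁ (here refl)
  corners-Adj (inj₁ refl)        (inj₂ (inj₂ refl)) _   = inj₁ (there (there (here refl)))
  corners-Adj (inj₂ (inj₁ refl)) (inj₁ refl)        _   = inj₂ (here refl)
  corners-Adj (inj₂ (inj₁ refl)) (inj₂ (inj₁ refl)) p~q = ⊥-elim (¬Adj-refl o p~q)
  corners-Adj (inj₂ (inj₁ refl)) (inj₂ (inj₂ refl)) _   = inj₁ (there (here refl))
  corners-Adj (inj₂ (inj₂ refl)) (inj₁ refl)        _   = inj₂ (there (there (here refl)))
  corners-Adj (inj₂ (inj₂ refl)) (inj₂ (inj₁ refl)) _   = inj₂ (there (here refl))
  corners-Adj (inj₂ (inj₂ refl)) (inj₂ (inj₂ refl)) p~q = ⊥-elim (¬Adj-refl o p~q)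

  -- In H − z the component of x stays inside {x, y}, because the only
  -- neighbours of x and y are corners; biconnectivity of H then leaves no
  -- room for vertices outside the triangle.
  module _ (H : Graph) (H⊑G : H ⊑ G) (triangle⊑H : triangle x y z ⊑ H) (bic : Biconnected H) where

    Adj-removeVertex⁻ : ∀ {a b} → Adj (removeVertex z H) a b → Adj H a b × b ≢ z
    Adj-removeVertex⁻ (inj₁ ab∈) = let (ab∈H , z∉ab) = ∈-filter⁻ (λ e → ¬? (incident? z e)) ab∈ in
      inj₁ ab∈H , λ b≡z → z∉ab (inj₂ (sym b≡z))
    Adj-removeVertex⁻ (inj₂ ba∈) = let (ba∈H , z∉ba) = ∈-filter⁻ (λ e → ¬? (incident? z e)) ba∈ in
      inj₂ ba∈H , λ b≡z → z∉ba (inj₁ (sym b≡z))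

    step-within-xy : ∀ {a b} → Adj (removeVertex z H) a b → a ≡ x ⊎ a ≡ y → b ≡ x ⊎ b ≡ y
    step-within-xy {b = b} a~b a∈xy with Adj-removeVertex⁻ a~b
    ... | (a~b∈H , b≢z) with H⊑G _ b a~b∈H | a∈xy
    ...   | a~b∈G | inj₁ refl with few-x y z b x~y x~z a~b∈G
    ...     | inj₁ y≡z        = ⊥-elim (Adj⇒≢ o y~z y≡z)
    ...     | inj₂ (inj₁ z≡b) = ⊥-elim (b≢z (sym z≡b))
    ...     | inj₂ (inj₂ y≡b) = inj₂ (sym y≡b)
    step-within-xy {b = b} a~b a∈xy | (a~b∈H , b≢z) | a~b∈G | inj₂ refl with few-y x z b (Adj-sym x~y) y~z a~b∈G
    ...     | inj₁ x≡z        = ⊥-elim (Adj⇒≢ o x~z x≡z)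
    ...     | inj₂ (inj₁ z≡b) = ⊥-elim (b≢z (sym z≡b))
    ...     | inj₂ (inj₂ x≡b) = inj₁ (sym x≡b)

    Reach-within-xy : ∀ {a b} → Reach (removeVertex z H) a b → a ≡ x ⊎ a ≡ y → b ≡ x ⊎ b ≡ y
    Reach-within-xy here           a∈xy = a∈xy
    Reach-within-xy (step a~c c⇝b) a∈xy = Reach-within-xy c⇝b (step-within-xy a~c a∈xy)

    vertices-are-corners : ∀ p → IsVertex H p → Corner p
    vertices-are-corners p p∈H with corner? p
    ... | yes corner = corner
    ... | no ¬corner with Reach-within-xy (proj₂ (proj₂ bic) z x p (y , triangle⊑H x y (inj₁ (here refl))) p∈H
                                            (Adj⇒≢ o x~z) (λ p≡z → ¬corner (inj₂ (inj₂ p≡z)))) (inj₁ refl)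
    ...   | inj₁ p≡x = ⊥-elim (¬corner (inj₁ p≡x))
    ...   | inj₂ p≡y = ⊥-elim (¬corner (inj₂ (inj₁ p≡y)))

    maximal : H ⊑ triangle x y z
    maximal p q p~q =
      corners-Adj (vertices-are-corners p (Adj⇒IsVertexˡ p~q)) (vertices-are-corners q (Adj⇒IsVertexʳ p~q))
                  (H⊑G p q p~q)

  block : TriangleBlock G x y z
  block = Adj⇒≢ o x~y , Adj⇒≢ o y~z , Adj⇒≢ o x~z , triangle-⊑ , maximal

propertyS⇒Admissible : ∀ {G} → IsSimpleGraph G → PropertyS G → Admissible G
propertyS⇒Admissible {G} (o , G!) (¬high-edge , ¬triangle-block) = record
  { oriented = o ; unique = G! ; triangle-free = triangle-free′ ; low-end = low-end′ }
  where
  low-end′ : ∀ x y → (x , y) ∈ G → AtMostTwoNeighbours G x ⊎ AtMostTwoNeighbours G y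
  low-end′ x y xy∈ with 2 <? degree G x
  ... | yes x-high = inj₂ (degree≤2⇒AtMostTwoNeighbours G y λ y-high → ¬high-edge x y xy∈ (x-high , y-high))
  ... | no ¬x-high = inj₁ (degree≤2⇒AtMostTwoNeighbours G x ¬x-high)
  low-end-Adj : ∀ {x y} → Adj G x y → AtMostTwoNeighbours G x ⊎ AtMostTwoNeighbours G y
  low-end-Adj (inj₁ xy∈) = low-end′ _ _ xy∈
  low-end-Adj (inj₂ yx∈) with low-end′ _ _ yx∈
  ... | inj₁ few-y = inj₂ few-y
  ... | inj₂ few-x = inj₁ few-x
  ¬low-triangle : ∀ {x y z} → AtMostTwoNeighbours G x → AtMostTwoNeighbours G y → Adj G x y → Adj G y z → Adj G x z → ⊥
  ¬low-triangle few-x few-y x~y y~z x~z = ¬triangle-block _ _ _ (LowTriangle.block G o few-x few-y x~y y~z x~z)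
  -- Two of the three edges' low ends are distinct corners.
  triangle-free′ : TriangleFree G
  triangle-free′ a b c a~b b~c a~c with low-end-Adj a~b
  ... | inj₁ few-a with low-end-Adj b~c
  ...   | inj₁ few-b = ¬low-triangle few-a few-b a~b b~c a~c
  ...   | inj₂ few-c = ¬low-triangle few-a few-c a~c (Adj-sym b~c) a~b
  triangle-free′ a b c a~b b~c a~c | inj₂ few-b with low-end-Adj a~c
  ...   | inj₁ few-a = ¬low-triangle few-a few-b a~b b~c a~c
  ...   | inj₂ few-c = ¬low-triangle few-b few-c b~c (Adj-sym a~c) (Adj-sym a~b)

theorem3 : (G : Graph) → IsSimpleGraph G → PropertyS G
    → (IsP G → Even (length G)) × (Even (length G) → IsP G)
theorem3 G simple S = P⇒even , even⇒P
  where
  adm : Admissible G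
  adm = propertyS⇒Admissible simple S
  even⇒P : Even (length G) → IsP G
  even⇒P (k , len≡2k) = proj₁ (parity-outcome k) G adm len≡2k
  P⇒even : IsP G → Even (length G)
  P⇒even P-G with even-or-odd (length G)
  ... | inj₁ even             = even
  ... | inj₂ (k , len≡1+2k) = ⊥-elim (N⇒¬P (proj₂ (parity-outcome k) G adm len≡1+2k) P-G)
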